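{- Let $m\ge 2$ be an integer with prime factorization $m=p_1^{e_1}\cdots p_s^{e_s}$, and let $d(m)=\prod_{i=1}^s(e_i+1)$ be the number of divisors of $m$. If $n_1<n_2<\dots<n_k$ are natural numbers with $g_m(n_1)=g_m(n_2)=\dots=g_m(n_k)$, then $k<d(m)$. In particular, the largest integer $k(m)$ for which such $n_1<\dots<n_{k(m)}$ exist satisfies $k(m)<d(m)$.
   Context: $\mathbb{N}=\{0,1,2,\dots\}$. For an integer $m\ge 2$, an $m$-product sequence is a finite sequence of integers $a_1\le a_2\le\dots\le a_t$ such that $\prod_{i=1}^t a_i=R^m$ for some $R\in\mathbb{N}$ and no integer appears more than $m-1$ times in the sequence. For $n\in\mathbb{N}$, $g_m(n)$ is the least integer $s$ such that there exists an $m$-product sequence $a_1\le\dots\le a_t$ with $a_1=n$ and $a_t=s$. -}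

module Defs where

open import Data.Nat using (ℕ; suc; _^_; _≤_; _<_; _≟_)
open import Data.Nat.Divisibility using (_∣?_)
open import Data.Nat.ListAction using (product)
open import Data.List using (List; []; _∷_; last; length; filter; upTo)
open import Data.List.Relation.Unary.Linked using (Linked)
open import Data.Maybe using (just)
open import Data.Product using (Σ; ∃; _×_)
open import Relation.Binary.PropositionalEquality using (_≡_)

occ : ℕ → List ℕ → ℕ
occ x xs = length (filter (x ≟_) xs)

MProductSeq : ℕ → List ℕ → Set
MProductSeq m as =
  Linked _≤_ as × (∃ λ (R : ℕ) → product as ≡ R ^ m) × (∀ x → occ x as < m)

MProductSeqFromTo : ℕ → ℕ → ℕ → List ℕ → Set
MProductSeqFromTo m n s as =
  MProductSeq m as × (∃ λ xs → as ≡ n ∷ xs) × (last as ≡ just s)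

-- g_m(n) = s : s is the least possible last term of an m-product sequence
-- starting with n
IsG : ℕ → ℕ → ℕ → Set
IsG m n s =
  (∃ λ as → MProductSeqFromTo m n s as) ×
  (∀ s' as → MProductSeqFromTo m n s' as → s ≤ s')

numDivisors : ℕ → ℕ
numDivisors m = length (filter (_∣? m) (upTo (suc m)))

-- Fix s ≠ 0 and call an exponent c completable from L when s ^ c times some product of
-- integers in [L, s) is an m-th power.  The completable exponents contain m and are closed
-- under addition and under c ↦ m ∸ c, so they form a subgroup of ℤ/mℤ: the least positive
-- one, d(L), divides m, and d(L) can only grow with L.  If g_m(n) = s, the occurrences of s
-- in an optimal sequence give a completable exponent below m, so d(n) is a proper divisor
-- of m.  For n < n' with g_m(n) = g_m(n') = s, d(n) = d(n') is impossible: the s's of the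
-- optimal sequence for n could then be cancelled by factors from (n, s), and reducing all
-- multiplicities modulo m would give an m-product sequence from n ending below s.  Hence
-- n ↦ d(n) maps n₁ < … < n_k strictly increasingly into the proper divisors of m.
-- The least positive exponent exists only classically; as the conclusion is decidable, the
-- argument runs under a double negation.

module Submission where

open import Level using (0ℓ)
open import Data.Nat
open import Data.Nat.Properties
open import Data.Nat.Divisibility
open import Data.Nat.DivMod
open import Data.Nat.GCD
open import Data.Nat.Coprimality using (Coprime; coprime-divisor; coprime-/gcd)
open import Data.Nat.Induction using (<-wellFounded)
open import Data.Nat.ListAction using (product)
open import Data.Nat.ListAction.Properties using (product-++; product≢0)
open import Data.Nat.Tactic.RingSolver using (solve-∀)
open import Algebra.Properties.CommutativeSemigroup *-commutativeSemigroup
  using (interchange; x∙yz≈y∙xz; xy∙z≈xz∙y)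
open import Data.List using (List; []; _∷_; _++_; concat; replicate; filter; length; last; upTo)
open import Data.List.Properties
  using ( filter-++; length-++; filter-none; filter-all; filter-accept; filter-reject
        ; length-replicate; length-filter)
open import Data.List.Membership.Propositional using (_∈_)
open import Data.List.Membership.Propositional.Properties using (∈-filter⁺; ∈-upTo⁺)
open import Data.List.Relation.Unary.Any using (here; there)
open import Data.List.Relation.Unary.All as All using (All; []; _∷_)
open import Data.List.Relation.Unary.All.Properties
  using (++⁺; concat⁺; replicate⁺; all-filter; filter⁺)
import Data.List.Relation.Unary.AllPairs as AllPairs
open import Data.List.Relation.Unary.Linked as Linked using (Linked; []; [-]; _∷_)
open import Data.List.Relation.Unary.Linked.Properties
  using (Linked⇒All; Linked⇒AllPairs; applyUpTo⁺₂) renaming (filter⁺ to linked-filter⁺)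
open import Data.Maybe using (just)
open import Data.Product using (∃; _×_; _,_; proj₁; map₁; map₂)
open import Effect.Monad using (RawMonad)
open import Function using (_∘′_)
open import Induction.WellFounded using (Acc; acc)
open import Relation.Binary.PropositionalEquality
open import Relation.Nullary using (¬_; ¬?; Dec; yes; no; contradiction)
open import Data.Empty using (⊥)
open import Relation.Nullary.Decidable using (decidable-stable)
open import Relation.Nullary.Negation using (¬¬-Monad; ¬¬-map)
open import Defs

IsPower : ℕ → ℕ → Set
IsPower m x = ∃ λ R → x ≡ R ^ m

^-distrib-* : ∀ a b n → (a * b) ^ n ≡ a ^ n * b ^ n
^-distrib-* a b zero    = refl
^-distrib-* a b (suc n) = begin
  a * b * (a * b) ^ n     ≡⟨ cong (a * b *_) (^-distrib-* a b n) ⟩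
  a * b * (a ^ n * b ^ n) ≡⟨ interchange a b (a ^ n) (b ^ n) ⟩
  a * a ^ n * (b * b ^ n) ∎
  where open ≡-Reasoning

0^n≡0 : ∀ n .{{_ : NonZero n}} → 0 ^ n ≡ 0
0^n≡0 (suc n) = refl

m∣m^n : ∀ m n .{{_ : NonZero n}} → m ∣ m ^ n
m∣m^n m (suc n) = m∣m*n (m ^ n)

coprime-∣-^⇒≡1 : ∀ {a b} n → Coprime a b → a ∣ b ^ n → a ≡ 1
coprime-∣-^⇒≡1 zero    _     a∣1   = ∣1⇒≡1 a∣1
coprime-∣-^⇒≡1 (suc n) a⊥b   a∣b^n = coprime-∣-^⇒≡1 n a⊥b (coprime-divisor a⊥b a∣b^n)

^-cancel-∣ : ∀ {a b} n .{{_ : NonZero n}} → a ≢ 0 → a ^ n ∣ b ^ n → a ∣ b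
^-cancel-∣ {a} {b} n a≢0 aⁿ∣bⁿ = subst (_∣ b) g≡a (gcd[m,n]∣n a b)
  where
  g = gcd a b
  instance
    g≢0 : NonZero g
    g≢0 = ≢-nonZero (a≢0 ∘′ gcd[m,n]≡0⇒m≡0)
  a≡a/g*g : a ≡ (a / g) * g
  a≡a/g*g = sym (m/n*n≡m (gcd[m,n]∣m a b))
  b≡b/g*g : b ≡ (b / g) * g
  b≡b/g*g = sym (m/n*n≡m (gcd[m,n]∣n a b))
  instance
    gⁿ≢0 : NonZero (g ^ n)
    gⁿ≢0 = m^n≢0 g n
  quotients∣ : (a / g) ^ n * g ^ n ∣ (b / g) ^ n * g ^ n
  quotients∣ = subst₂ _∣_
    (trans (cong (_^ n) a≡a/g*g) (^-distrib-* (a / g) g n))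
    (trans (cong (_^ n) b≡b/g*g) (^-distrib-* (b / g) g n)) aⁿ∣bⁿ
  a/g≡1 : a / g ≡ 1
  a/g≡1 = coprime-∣-^⇒≡1 n (coprime-/gcd a b)
    (∣-trans (m∣m^n (a / g) n) (*-cancelʳ-∣ (g ^ n) quotients∣))
  g≡a : g ≡ a
  g≡a = trans (sym (*-identityˡ g)) (trans (cong (_* g) (sym a/g≡1)) (sym a≡a/g*g))

isPower-* : ∀ {m a b} → IsPower m a → IsPower m b → IsPower m (a * b)
isPower-* {m} (R , refl) (T , refl) = R * T , sym (^-distrib-* R T m)

isPower-cancelʳ : ∀ {m a b} .{{_ : NonZero m}} → b ≢ 0 →
                  IsPower m b → IsPower m (a * b) → IsPower m a
isPower-cancelʳ {m} {a} Rᵐ≢0 (R , refl) (T , aRᵐ≡Tᵐ)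
  with ^-cancel-∣ m R≢0 (divides a (sym aRᵐ≡Tᵐ))
  where
  R≢0 : R ≢ 0
  R≢0 refl = Rᵐ≢0 (0^n≡0 m)
... | divides U refl =
  U , *-cancelʳ-≡ a (U ^ m) (R ^ m) {{≢-nonZero Rᵐ≢0}} (trans aRᵐ≡Tᵐ (^-distrib-* U R m))

product-replicate : ∀ k a → product (replicate k a) ≡ a ^ k
product-replicate zero    a = refl
product-replicate (suc k) a = cong (a *_) (product-replicate k a)

product-concat-replicate : ∀ k xs → product (concat (replicate k xs)) ≡ product xs ^ k
product-concat-replicate zero    xs = refl
product-concat-replicate (suc k) xs = begin
  product (xs ++ concat (replicate k xs))        ≡⟨ product-++ xs _ ⟩
  product xs * product (concat (replicate k xs)) ≡⟨ cong (product xs *_) (product-concat-replicate k xs) ⟩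
  product xs * product xs ^ k                    ∎
  where open ≡-Reasoning

without : ℕ → List ℕ → List ℕ
without x = filter (λ y → ¬? (x ≟ y))

occ-here : ∀ x xs → occ x (x ∷ xs) ≡ suc (occ x xs)
occ-here x xs = cong length (filter-accept (x ≟_) refl)

occ-there : ∀ {x y} xs → x ≢ y → occ x (y ∷ xs) ≡ occ x xs
occ-there xs x≢y = cong length (filter-reject (_ ≟_) x≢y)

without-here : ∀ x xs → without x (x ∷ xs) ≡ without x xs
without-here x xs = filter-reject (λ y → ¬? (x ≟ y)) (λ x≢x → x≢x refl)

without-there : ∀ {x y} xs → x ≢ y → without x (y ∷ xs) ≡ y ∷ without x xs
without-there xs x≢y = filter-accept (λ y → ¬? (_ ≟ y)) x≢y

product-occ : ∀ x xs → product xs ≡ x ^ occ x xs * product (without x xs)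
product-occ x []       = refl
product-occ x (y ∷ ys) with x ≟ y
... | yes refl = begin
  x * product ys                                ≡⟨ cong (x *_) (product-occ x ys) ⟩
  x * (x ^ occ x ys * product (without x ys))   ≡⟨ *-assoc x _ _ ⟨
  x ^ suc (occ x ys) * product (without x ys)
    ≡⟨ cong₂ (λ k xs → x ^ k * product xs) (occ-here x ys) (without-here x ys) ⟨
  x ^ occ x (x ∷ ys) * product (without x (x ∷ ys)) ∎
  where open ≡-Reasoning
... | no x≢y   = begin
  y * product ys                                ≡⟨ cong (y *_) (product-occ x ys) ⟩
  y * (x ^ occ x ys * product (without x ys))   ≡⟨ x∙yz≈y∙xz y (x ^ occ x ys) _ ⟩
  x ^ occ x ys * (y * product (without x ys))
    ≡⟨ cong₂ (λ k xs → x ^ k * product xs) (occ-there ys x≢y) (without-there ys x≢y) ⟨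
  x ^ occ x (y ∷ ys) * product (without x (y ∷ ys)) ∎
  where open ≡-Reasoning

occ-without : ∀ {x y} xs → x ≢ y → occ x (without y xs) ≡ occ x xs
occ-without []       x≢y = refl
occ-without {x} {y} (z ∷ zs) x≢y with y ≟ z | x ≟ z
... | yes refl | yes refl = contradiction refl x≢y
... | yes refl | no x≢z   = begin
  occ x (without y (y ∷ zs)) ≡⟨ cong (occ x) (without-here y zs) ⟩
  occ x (without y zs)       ≡⟨ occ-without zs x≢y ⟩
  occ x zs                   ≡⟨ occ-there zs x≢z ⟨
  occ x (y ∷ zs)             ∎
  where open ≡-Reasoning
... | no y≢z   | yes refl = begin
  occ x (without y (x ∷ zs)) ≡⟨ cong (occ x) (without-there zs y≢z) ⟩
  occ x (x ∷ without y zs)   ≡⟨ occ-here x _ ⟩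
  suc (occ x (without y zs)) ≡⟨ cong suc (occ-without zs x≢y) ⟩
  suc (occ x zs)             ≡⟨ occ-here x zs ⟨
  occ x (x ∷ zs)             ∎
  where open ≡-Reasoning
... | no y≢z   | no x≢z   = begin
  occ x (without y (z ∷ zs)) ≡⟨ cong (occ x) (without-there zs y≢z) ⟩
  occ x (z ∷ without y zs)   ≡⟨ occ-there _ x≢z ⟩
  occ x (without y zs)       ≡⟨ occ-without zs x≢y ⟩
  occ x zs                   ≡⟨ occ-there zs x≢z ⟨
  occ x (z ∷ zs)             ∎
  where open ≡-Reasoning

occ-++ : ∀ x xs ys → occ x (xs ++ ys) ≡ occ x xs + occ x ys
occ-++ x xs ys = trans (cong length (filter-++ (x ≟_) xs ys)) (length-++ (filter (x ≟_) xs))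

occ-absent : ∀ {x} ys → All (x ≢_) ys → occ x ys ≡ 0
occ-absent ys x∉ys = cong length (filter-none (_ ≟_) x∉ys)

occ-replicate : ∀ k x → occ x (replicate k x) ≡ k
occ-replicate k x = trans (cong length (filter-all (x ≟_) (replicate⁺ k refl))) (length-replicate k)

occ-∈ : ∀ {x xs} → x ∈ xs → 1 ≤ occ x xs
occ-∈ {x} x∈xs = nonEmpty (∈-filter⁺ (x ≟_) x∈xs refl)
  where
  nonEmpty : ∀ {ys : List ℕ} → x ∈ ys → 1 ≤ length ys
  nonEmpty (here _)  = s≤s z≤n
  nonEmpty (there _) = s≤s z≤n

linked-∷ : ∀ {x ys} → All (x ≤_) ys → Linked _≤_ ys → Linked _≤_ (x ∷ ys)
linked-∷ []           []  = [-]
linked-∷ (x≤y ∷ _)    ys↗ = x≤y ∷ ys↗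

linked-replicate-++ : ∀ k {a ys} → All (a ≤_) ys → Linked _≤_ ys →
                      Linked _≤_ (replicate k a ++ ys)
linked-replicate-++ zero    a≤ys ys↗ = ys↗
linked-replicate-++ (suc k) a≤ys ys↗ =
  linked-∷ (++⁺ (replicate⁺ k ≤-refl) a≤ys) (linked-replicate-++ k a≤ys ys↗)

linked-head : ∀ {x xs} → Linked _≤_ (x ∷ xs) → All (x ≤_) (x ∷ xs)
linked-head [-]          = ≤-refl ∷ []
linked-head (x≤y ∷ xs↗) = ≤-refl ∷ Linked⇒All ≤-trans x≤y xs↗

linked-last : ∀ {y} (xs : List ℕ) → Linked _≤_ xs → last xs ≡ just y → All (_≤ y) xs
linked-last (x ∷ [])     [-]         refl = ≤-refl ∷ []
linked-last (x ∷ x' ∷ xs) (x≤x' ∷ xs↗) eq with linked-last (x' ∷ xs) xs↗ eq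
... | x'≤y ∷ xs≤y = ≤-trans x≤x' x'≤y ∷ x'≤y ∷ xs≤y

last-∈ : ∀ {y : ℕ} xs → last xs ≡ just y → y ∈ xs
last-∈ (x ∷ [])     refl = here refl
last-∈ (x ∷ x' ∷ xs) eq  = there (last-∈ (x' ∷ xs) eq)

last-satisfies : ∀ {P : ℕ → Set} x xs → All P (x ∷ xs) →
                 ∃ λ y → last (x ∷ xs) ≡ just y × P y
last-satisfies x []        (px ∷ [])  = x , refl , px
last-satisfies {P} x (x' ∷ xs) (_ ∷ pxs) = last-satisfies {P} x' xs pxs

linked-<-head-min : ∀ {x y xs} → Linked _<_ (x ∷ xs) → y ∈ x ∷ xs → x ≤ y
linked-<-head-min _            (here refl) = ≤-refl
linked-<-head-min xs↗         (there y∈xs) =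
  <⇒≤ (All.lookup (AllPairs.head (Linked⇒AllPairs <-trans xs↗)) y∈xs)

∈-∷-above : ∀ {x y} {xs : List ℕ} → x < y → y ∈ x ∷ xs → y ∈ xs
∈-∷-above x<y (here refl)  = contradiction x<y (<-irrefl refl)
∈-∷-above x<y (there y∈xs) = y∈xs

length-<-sorted-⊆ : ∀ {xs ds y} → Linked _<_ xs → Linked _<_ ds → y ∈ xs →
                    All (λ d → d ∈ xs × d < y) ds → length ds < length xs
length-<-sorted-⊆ {x ∷ _} xs↗ ds↗ y∈xs [] = s≤s z≤n
length-<-sorted-⊆ {x ∷ _} {d ∷ ds} xs↗ ds↗ y∈xs ((d∈xs , d<y) ∷ ds∈xs) =
  s≤s (length-<-sorted-⊆ (Linked.tail xs↗) (Linked.tail ds↗) (∈-∷-above x<y y∈xs)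
    (All.zipWith (λ (d<e , e∈xs , e<y) → ∈-∷-above (≤-<-trans x≤d d<e) e∈xs , e<y)
      (d<ds , ds∈xs)))
  where
  x≤d = linked-<-head-min xs↗ d∈xs
  x<y = ≤-<-trans x≤d d<y
  d<ds : All (d <_) ds
  d<ds = AllPairs.head (Linked⇒AllPairs <-trans ds↗)

proper-divisors-count : ∀ {m ds} → Linked _<_ ds → All (λ d → d ∣ m × d < m) ds →
                        length ds < numDivisors m
proper-divisors-count {m} ds↗ ds∣m = length-<-sorted-⊆ divisors↗ ds↗ (divisor ∣-refl ≤-refl)
  (All.map (λ (d∣m , d<m) → divisor d∣m (<⇒≤ d<m) , d<m) ds∣m)
  where
  divisors↗ : Linked _<_ (filter (_∣? m) (upTo (suc m)))
  divisors↗ = linked-filter⁺ (_∣? m) <-trans (applyUpTo⁺₂ (λ i → i) (suc m) n<1+n)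
  divisor : ∀ {d} → d ∣ m → d ≤ m → d ∈ filter (_∣? m) (upTo (suc m))
  divisor d∣m d≤m = ∈-filter⁺ (_∣? m) (∈-upTo⁺ (s≤s d≤m)) d∣m

expand : ℕ → List ℕ → List ℕ
expand a []       = []
expand a (k ∷ ks) = replicate k a ++ expand (suc a) ks

expand-zeros : ∀ a len → expand a (replicate len 0) ≡ []
expand-zeros a zero      = refl
expand-zeros a (suc len) = expand-zeros (suc a) len

product-expand : ∀ a k ks → product (expand a (k ∷ ks)) ≡ a ^ k * product (expand (suc a) ks)
product-expand a k ks =
  trans (product-++ (replicate k a) _) (cong (_* product (expand (suc a) ks)) (product-replicate k a))

expand-inRange : ∀ a ks → All (λ y → a ≤ y × y < a + length ks) (expand a ks)
expand-inRange a []       = []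
expand-inRange a (k ∷ ks) = ++⁺ (replicate⁺ k (≤-refl , a<a+1+len))
  (All.map (λ {y} (1+a≤y , y<1+a+len) →
             <⇒≤ 1+a≤y , subst (y <_) (sym (+-suc a (length ks))) y<1+a+len)
    (expand-inRange (suc a) ks))
  where
  a<a+1+len : a < a + suc (length ks)
  a<a+1+len = m<m+n a (s≤s z≤n)

expand-sorted : ∀ a ks → Linked _≤_ (expand a ks)
expand-sorted a []       = []
expand-sorted a (k ∷ ks) = linked-replicate-++ k
  (All.map (λ (1+a≤y , _) → <⇒≤ 1+a≤y) (expand-inRange (suc a) ks)) (expand-sorted (suc a) ks)

occ-expand : ∀ {b} → 1 ≤ b → ∀ a ks → All (_< b) ks → ∀ x → occ x (expand a ks) < b
occ-expand 1≤b a []       []          x = 1≤b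
occ-expand 1≤b a (k ∷ ks) (k<b ∷ ks<b) x with x ≟ a
... | yes refl = subst (_< _) (sym occ≡k) k<b
  where
  x∉rest : All (x ≢_) (expand (suc x) ks)
  x∉rest = All.map (λ (x<y , _) → <⇒≢ x<y) (expand-inRange (suc x) ks)
  occ≡k : occ x (expand x (k ∷ ks)) ≡ k
  occ≡k = begin
    occ x (replicate k x ++ expand (suc x) ks)        ≡⟨ occ-++ x (replicate k x) _ ⟩
    occ x (replicate k x) + occ x (expand (suc x) ks)
      ≡⟨ cong₂ _+_ (occ-replicate k x) (occ-absent _ x∉rest) ⟩
    k + 0                                             ≡⟨ +-identityʳ k ⟩
    k                                                 ∎
    where open ≡-Reasoning
... | no x≢a = subst (_< _) (sym occ≡rest) (occ-expand 1≤b (suc a) ks ks<b x)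
  where
  occ≡rest : occ x (expand a (k ∷ ks)) ≡ occ x (expand (suc a) ks)
  occ≡rest = trans (occ-++ x (replicate k a) _)
    (cong (_+ occ x (expand (suc a) ks)) (occ-absent _ (replicate⁺ k x≢a)))

module Reduction (m : ℕ) .{{_ : NonZero m}} where

  bump : ℕ → List ℕ → List ℕ
  bump i       []       = []
  bump zero    (k ∷ ks) = suc k % m ∷ ks
  bump (suc i) (k ∷ ks) = k ∷ bump i ks

  length-bump : ∀ i ks → length (bump i ks) ≡ length ks
  length-bump i       []       = refl
  length-bump zero    (k ∷ ks) = refl
  length-bump (suc i) (k ∷ ks) = cong suc (length-bump i ks)

  bump-bounded : ∀ i {ks} → All (_< m) ks → All (_< m) (bump i ks)
  bump-bounded i       []            = []
  bump-bounded zero    {k ∷ _} (_ ∷ ks<m) = m%n<n (suc k) m ∷ ks<m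
  bump-bounded (suc i) (k<m ∷ ks<m) = k<m ∷ bump-bounded i ks<m

  product-bump : ∀ a i ks → i < length ks →
                 ∃ λ Q → (a + i) * product (expand a ks) ≡ product (expand a (bump i ks)) * Q ^ m
  product-bump a zero (k ∷ ks) _ = a ^ (suc k / m) , (begin
    (a + 0) * product (expand a (k ∷ ks))  ≡⟨ cong₂ _*_ (+-identityʳ a) (product-expand a k ks) ⟩
    a * (a ^ k * P)                        ≡⟨ *-assoc a (a ^ k) P ⟨
    a ^ suc k * P                          ≡⟨ cong (λ j → a ^ j * P) (m≡m%n+[m/n]*n (suc k) m) ⟩
    a ^ (r + q * m) * P                    ≡⟨ cong (_* P) (^-distribˡ-+-* a r (q * m)) ⟩
    a ^ r * a ^ (q * m) * P                ≡⟨ cong (λ x → a ^ r * x * P) (^-*-assoc a q m) ⟨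
    a ^ r * (a ^ q) ^ m * P                ≡⟨ xy∙z≈xz∙y (a ^ r) _ P ⟩
    a ^ r * P * (a ^ q) ^ m                ≡⟨ cong (_* (a ^ q) ^ m) (product-expand a r ks) ⟨
    product (expand a (r ∷ ks)) * (a ^ q) ^ m ∎)
    where
    open ≡-Reasoning
    P = product (expand (suc a) ks)
    r = suc k % m
    q = suc k / m
  product-bump a (suc i) (k ∷ ks) (s≤s i<len) with product-bump (suc a) i ks i<len
  ... | Q , eq = Q , (begin
    (a + suc i) * product (expand a (k ∷ ks))  ≡⟨ cong₂ _*_ (+-suc a i) (product-expand a k ks) ⟩
    (suc a + i) * (a ^ k * P)                  ≡⟨ x∙yz≈y∙xz (suc a + i) (a ^ k) P ⟩
    a ^ k * ((suc a + i) * P)                  ≡⟨ cong (a ^ k *_) eq ⟩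
    a ^ k * (P' * Q ^ m)                       ≡⟨ *-assoc (a ^ k) P' (Q ^ m) ⟨
    a ^ k * P' * Q ^ m                         ≡⟨ cong (_* Q ^ m) (product-expand a k (bump i ks)) ⟨
    product (expand a (k ∷ bump i ks)) * Q ^ m ∎)
    where
    open ≡-Reasoning
    P  = product (expand (suc a) ks)
    P' = product (expand (suc a) (bump i ks))

  record NormalForm (a len x : ℕ) : Set where
    constructor normalForm
    field
      multiplicities : List ℕ
      length≡        : length multiplicities ≡ len
      bounded        : All (_< m) multiplicities
      cofactor       : ℕ
      x≡             : x ≡ product (expand a multiplicities) * cofactor ^ m

  normalForm-product : ∀ a len zs → All (λ z → a ≤ z × z < a + len) zs →
                       NormalForm a len (product zs)
  normalForm-product a len [] [] =
    normalForm (replicate len 0) (length-replicate len) (replicate⁺ len (>-nonZero⁻¹ m)) 1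
      (sym (trans (cong (λ xs → product xs * 1 ^ m) (expand-zeros a len))
                  (trans (*-identityˡ _) (^-zeroˡ m))))
  normalForm-product a len (z ∷ zs) ((a≤z , z<a+len) ∷ zs∈)
    with normalForm ks len≡ ks<m Q eq ← normalForm-product a len zs zs∈
    with Q' , eq' ← product-bump a (z ∸ a) ks
           (subst (z ∸ a <_) (trans (m+n∸m≡n a len) (sym len≡)) (∸-monoˡ-< z<a+len a≤z))
    = normalForm (bump (z ∸ a) ks) (trans (length-bump (z ∸ a) ks) len≡) (bump-bounded (z ∸ a) ks<m)
        (Q' * Q) (begin
      z * product zs                           ≡⟨ cong (z *_) eq ⟩
      z * (P * Q ^ m)                          ≡⟨ *-assoc z P (Q ^ m) ⟨
      z * P * Q ^ m                            ≡⟨ cong (λ x → x * P * Q ^ m) (m+[n∸m]≡n a≤z) ⟨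
      (a + (z ∸ a)) * P * Q ^ m                ≡⟨ cong (_* Q ^ m) eq' ⟩
      P' * Q' ^ m * Q ^ m                      ≡⟨ *-assoc P' (Q' ^ m) (Q ^ m) ⟩
      P' * (Q' ^ m * Q ^ m)                    ≡⟨ cong (P' *_) (^-distrib-* Q' Q m) ⟨
      P' * (Q' * Q) ^ m                        ∎)
    where
    open ≡-Reasoning
    P  = product (expand a ks)
    P' = product (expand a (bump (z ∸ a) ks))

sequence-bounds : ∀ {m n s as} → MProductSeqFromTo m n s as → All (λ y → n ≤ y × y ≤ s) as
sequence-bounds {as = as} ((as↗ , _ , _) , (_ , refl) , last≡s) =
  All.zip (linked-head as↗ , linked-last as as↗ last≡s)

sequence-≤ : ∀ {m n s as} → MProductSeqFromTo m n s as → n ≤ s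
sequence-≤ sq@(_ , (_ , refl) , _) with (_ , n≤s) ∷ _ ← sequence-bounds sq = n≤s

sequence-occ<m : ∀ {m n s as} → MProductSeqFromTo m n s as → ∀ x → occ x as < m
sequence-occ<m ((_ , _ , occ<m) , _) = occ<m

sequence-occ-head : ∀ {m n s as} → MProductSeqFromTo m n s as → 1 ≤ occ n as
sequence-occ-head {n = n} (_ , (_ , refl) , _) = occ-∈ {n} (here refl)

sequence-occ-last : ∀ {m n s as} → MProductSeqFromTo m n s as → 1 ≤ occ s as
sequence-occ-last {as = as} (_ , _ , last≡s) = occ-∈ (last-∈ as last≡s)

zero-sequence : ∀ {m} → 2 ≤ m → MProductSeqFromTo m 0 0 (0 ∷ [])
zero-sequence {suc m} 2≤m = ([-] , (0 , refl) , occ<m) , (_ , refl) , refl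
  where
  occ<m : ∀ x → occ x (0 ∷ []) < suc m
  occ<m x = ≤-<-trans (length-filter (x ≟_) (0 ∷ [])) 2≤m

isG-≤ : ∀ {m n s} → IsG m n s → n ≤ s
isG-≤ ((_ , sq) , _) = sequence-≤ sq

isG-no-shorter : ∀ {m n s} → IsG m n s → ¬ (∃ λ s' → s' < s × ∃ (MProductSeqFromTo m n s'))
isG-no-shorter (_ , minimal) (s' , s'<s , as' , sq') = <⇒≱ s'<s (minimal s' as' sq')

Least : (ℕ → Set) → ℕ → Set
Least P d = P d × (∀ {c} → c < d → ¬ P c)

¬¬-least : ∀ {P : ℕ → Set} {n} → P n → ¬ ¬ ∃ (Least P)
¬¬-least {P} = go (<-wellFounded _)
  where
  go : ∀ {n} → Acc _<_ n → P n → ¬ ¬ ∃ (Least P)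
  go (acc rs) pn noLeast = noLeast (_ , pn , λ c<n pc → go (rs c<n) pc noLeast)

module Completion (m s : ℕ) .{{_ : NonZero m}} .{{_ : NonZero s}} where

  open Reduction m

  InRange : ℕ → ℕ → Set
  InRange L z = L ≤ z × z < s

  record Completable (B L c : ℕ) : Set where
    constructor completion
    field
      factors  : List ℕ
      inRange  : All (InRange L) factors
      isPower  : IsPower m (B * product factors * s ^ c)

  completable-m : ∀ L → Completable 1 L m
  completable-m L = completion [] [] (s , +-identityʳ (s ^ m))

  completable-mono : ∀ {B L L' c} → L ≤ L' → Completable B L' c → Completable B L c
  completable-mono L≤L' (completion F F∈ pow) = completion F (All.map (map₁ (≤-trans L≤L')) F∈) pow

  completable-+ : ∀ {B L c c'} → Completable B L c → Completable 1 L c' → Completable B L (c + c')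
  completable-+ {B} {L} {c} {c'} (completion F F∈ pow) (completion F' F'∈ pow') =
    completion (F ++ F') (++⁺ F∈ F'∈) (subst (IsPower m) (sym eq) (isPower-* {m} pow pow'))
    where
    regroup : ∀ B P P' x y → B * (P * P') * (x * y) ≡ (B * P * x) * (1 * P' * y)
    regroup = solve-∀
    eq : B * product (F ++ F') * s ^ (c + c') ≡ (B * product F * s ^ c) * (1 * product F' * s ^ c')
    eq = begin
      B * product (F ++ F') * s ^ (c + c')
        ≡⟨ cong₂ (λ P x → B * P * x) (product-++ F F') (^-distribˡ-+-* s c c') ⟩
      B * (product F * product F') * (s ^ c * s ^ c')
        ≡⟨ regroup B (product F) (product F') (s ^ c) (s ^ c') ⟩
      (B * product F * s ^ c) * (1 * product F' * s ^ c') ∎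
      where open ≡-Reasoning

  completable-dropᵐ : ∀ {B L c} → Completable B L (c + m) → Completable B L c
  completable-dropᵐ {B} {L} {c} (completion F F∈ pow) =
    completion F F∈
      (isPower-cancelʳ {m} (≢-nonZero⁻¹ (s ^ m) {{m^n≢0 s m}}) (s , refl) (subst (IsPower m) eq pow))
    where
    eq : B * product F * s ^ (c + m) ≡ B * product F * s ^ c * s ^ m
    eq = trans (cong (B * product F *_) (^-distribˡ-+-* s c m)) (sym (*-assoc (B * product F) (s ^ c) (s ^ m)))

  product-inRange-nonZero : ∀ {L} → 1 ≤ L → {F : List ℕ} → All (InRange L) F → NonZero (product F)
  product-inRange-nonZero 1≤L F∈ =
    product≢0 (All.map (λ (L≤z , _) → >-nonZero (≤-trans 1≤L L≤z)) F∈)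

  completable-neg : ∀ {L c} → 1 ≤ L → c ≤ m → Completable 1 L c → Completable 1 L (m ∸ c)
  completable-neg {L} {c} 1≤L c≤m (completion F F∈ pow) =
    completion Fᵐ⁻¹ (concat⁺ (replicate⁺ (pred m) F∈))
      (isPower-cancelʳ {m} Psᶜ≢0 pow (subst (IsPower m) (sym eq) (P * s , refl)))
    where
    P = product F
    Fᵐ⁻¹ = concat (replicate (pred m) F)
    instance
      P≢0 : NonZero P
      P≢0 = product-inRange-nonZero 1≤L F∈
    Psᶜ≢0 : 1 * P * s ^ c ≢ 0
    Psᶜ≢0 = ≢-nonZero⁻¹ _ {{m*n≢0 (1 * P) (s ^ c) {{m*n≢0 1 P}} {{m^n≢0 s c}}}}
    regroup : ∀ X Y P Z → 1 * X * Y * (1 * P * Z) ≡ X * P * (Y * Z)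
    regroup = solve-∀
    eq : 1 * product Fᵐ⁻¹ * s ^ (m ∸ c) * (1 * P * s ^ c) ≡ (P * s) ^ m
    eq = begin
      1 * product Fᵐ⁻¹ * s ^ (m ∸ c) * (1 * P * s ^ c)
        ≡⟨ regroup (product Fᵐ⁻¹) (s ^ (m ∸ c)) P (s ^ c) ⟩
      product Fᵐ⁻¹ * P * (s ^ (m ∸ c) * s ^ c)
        ≡⟨ cong₂ _*_ (cong (_* P) (product-concat-replicate (pred m) F))
                     (sym (^-distribˡ-+-* s (m ∸ c) c)) ⟩
      P ^ pred m * P * s ^ (m ∸ c + c)
        ≡⟨ cong₂ _*_ (*-comm (P ^ pred m) P) (cong (s ^_) (m∸n+n≡m c≤m)) ⟩
      P ^ suc (pred m) * s ^ m  ≡⟨ cong (λ k → P ^ k * s ^ m) (suc-pred m) ⟩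
      P ^ m * s ^ m             ≡⟨ sym (^-distrib-* P s m) ⟩
      (P * s) ^ m               ∎
      where open ≡-Reasoning

  completable-∸ : ∀ {B L c c'} → 1 ≤ L → c' ≤ c → c' ≤ m →
                  Completable B L c → Completable 1 L c' → Completable B L (c ∸ c')
  completable-∸ {B} {L} {c} {c'} 1≤L c'≤c c'≤m g g' =
    completable-dropᵐ (subst (Completable B L) eq (completable-+ g (completable-neg 1≤L c'≤m g')))
    where
    eq : c + (m ∸ c') ≡ c ∸ c' + m
    eq = trans (sym (+-∸-assoc c c'≤m)) (+-∸-comm m c'≤c)

  completable-0 : ∀ L → Completable 1 L 0
  completable-0 L = completion [] [] (1 , sym (^-zeroˡ m))

  completable-* : ∀ {L d} q → Completable 1 L d → Completable 1 L (q * d)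
  completable-* {L} zero    g = completable-0 L
  completable-* (suc q) g = completable-+ g (completable-* q g)

  completable-∣ : ∀ {L d c} → d ∣ c → Completable 1 L d → Completable 1 L c
  completable-∣ (divides q refl) = completable-* q

  completable-% : ∀ {B L c d} .{{_ : NonZero d}} → 1 ≤ L → c ≤ m →
                  Completable B L c → Completable 1 L d → Completable B L (c % d)
  completable-% {B} {L} {c} {d} 1≤L c≤m g g' = subst (Completable B L) (sym (m%n≡m∸m/n*n c d))
    (completable-∸ 1≤L (m/n*n≤m c d) (≤-trans (m/n*n≤m c d) c≤m) g
      (completable-∣ (divides (c / d) refl) g'))

  sequence-completable : ∀ {n as} → MProductSeqFromTo m n s as → Completable 1 n (occ s as)
  sequence-completable {n} {as} sq@((_ , (R , as≡Rᵐ) , _) , _) =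
    completion (without s as) range (R , eq)
    where
    range : All (InRange n) (without s as)
    range = All.zipWith (λ ((n≤y , y≤s) , y≢s) → n≤y , ≤∧≢⇒< y≤s (≢-sym y≢s))
      (filter⁺ _ (sequence-bounds sq) , all-filter (λ y → ¬? (s ≟ y)) as)
    eq : 1 * product (without s as) * s ^ occ s as ≡ R ^ m
    eq = begin
      1 * product (without s as) * s ^ occ s as
        ≡⟨ cong (_* s ^ occ s as) (*-identityˡ (product (without s as))) ⟩
      product (without s as) * s ^ occ s as     ≡⟨ *-comm (product (without s as)) _ ⟩
      s ^ occ s as * product (without s as)     ≡⟨ product-occ s as ⟨
      product as                                ≡⟨ as≡Rᵐ ⟩
      R ^ m                                     ∎
      where open ≡-Reasoning

  completable-peel : ∀ {L c} (g : Completable 1 L c) →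
                     Completable (L ^ occ L (Completable.factors g)) (suc L) c
  completable-peel {L} {c} (completion F F∈ pow) =
    completion (without L F) range (subst (IsPower m) eq pow)
    where
    range : All (InRange (suc L)) (without L F)
    range = All.zipWith (λ ((L≤y , y<s) , L≢y) → ≤∧≢⇒< L≤y L≢y , y<s)
      (filter⁺ _ F∈ , all-filter (λ y → ¬? (L ≟ y)) F)
    eq : 1 * product F * s ^ c ≡ L ^ occ L F * product (without L F) * s ^ c
    eq = cong (_* s ^ c) (trans (*-identityˡ (product F)) (product-occ L F))

  sequence-completable-above : ∀ {n as} → n < s → MProductSeqFromTo m n s as →
                               Completable (n ^ occ n as) (suc n) (occ s as)
  sequence-completable-above {n} {as} n<s sq =
    subst (λ k → Completable (n ^ k) (suc n) (occ s as)) (occ-without as (<⇒≢ n<s))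
      (completable-peel (sequence-completable sq))

  shorter-sequence : ∀ {n e} → 1 ≤ n → n < s → 1 ≤ e → e < m → Completable (n ^ e) (suc n) 0 →
                     ∃ λ s' → s' < s × ∃ (MProductSeqFromTo m n s')
  shorter-sequence {n} {suc e} 1≤n n<s (s≤s z≤n) e<m (completion F F∈ (R , eq))
    with normalForm ks len≡ ks<m Q F≡ ← normalForm-product (suc n) (s ∸ suc n) F
           (All.map (λ {z} → map₂ (subst (z <_) (sym (m+[n∸m]≡n n<s)))) F∈)
    with s' , last≡s' , (_ , s'<n+len) ← last-satisfies n _ (expand-inRange n (suc e ∷ ks))
    = s' , subst (s' <_) n+len≡s s'<n+len ,
      expand n (suc e ∷ ks) ,
      (expand-sorted n (suc e ∷ ks) , power , occ-expand (>-nonZero⁻¹ m) n (suc e ∷ ks) (e<m ∷ ks<m)) ,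
      (_ , refl) , last≡s'
    where
    open ≡-Reasoning
    P = product (expand (suc n) ks)
    n+len≡s : n + length (suc e ∷ ks) ≡ s
    n+len≡s = trans (+-suc n (length ks)) (trans (cong (suc n +_) len≡) (m+[n∸m]≡n n<s))
    Qᵐ≢0 : Q ^ m ≢ 0
    Qᵐ≢0 Qᵐ≡0 = ≢-nonZero⁻¹ (product F) {{product-inRange-nonZero (s≤s z≤n) F∈}}
      (trans F≡ (trans (cong (P *_) Qᵐ≡0) (*-zeroʳ P)))
    regroup : n ^ suc e * product F * s ^ 0 ≡ product (expand n (suc e ∷ ks)) * Q ^ m
    regroup = begin
      n ^ suc e * product F * 1 ≡⟨ *-identityʳ _ ⟩
      n ^ suc e * product F     ≡⟨ cong (n ^ suc e *_) F≡ ⟩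
      n ^ suc e * (P * Q ^ m)   ≡⟨ *-assoc (n ^ suc e) P (Q ^ m) ⟨
      n ^ suc e * P * Q ^ m     ≡⟨ cong (_* Q ^ m) (product-expand n (suc e) ks) ⟨
      product (expand n (suc e ∷ ks)) * Q ^ m ∎
    power : IsPower m (product (expand n (suc e ∷ ks)))
    power = isPower-cancelʳ {m} Qᵐ≢0 (Q , refl) (subst (IsPower m) regroup (R , eq))

module Exponents (m s : ℕ) (2≤m : 2 ≤ m) .{{_ : NonZero s}} where

  0<m : 0 < m
  0<m = <-trans z<s 2≤m

  instance
    m≢0 : NonZero m
    m≢0 = >-nonZero 0<m

  open Completion m s

  PositiveExponent : ℕ → ℕ → Set
  PositiveExponent L c = 1 ≤ c × Completable 1 L c

  isG-positive : ∀ {n} → IsG m n s → 1 ≤ n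
  isG-positive {zero}  (_ , minimal) =
    contradiction (n≤0⇒n≡0 (minimal 0 _ (zero-sequence 2≤m))) (≢-nonZero⁻¹ s)
  isG-positive {suc n} _             = s≤s z≤n

  isG-exponent : ∀ {n} → IsG m n s → ∃ λ c → c < m × PositiveExponent n c
  isG-exponent ((as , sq) , _) = occ s as , sequence-occ<m sq s , sequence-occ-last sq , sequence-completable sq

  least-∣ : ∀ {L d c} → 1 ≤ L → Least (PositiveExponent L) d →
            c ≤ m → Completable 1 L c → d ∣ c
  least-∣ {L} {d} {c} 1≤L ((1≤d , g-d) , minimal) c≤m g-c = goal (c % d ≟ 0)
    where
    instance
      d≢0 : NonZero d
      d≢0 = >-nonZero 1≤d
    goal : Dec (c % d ≡ 0) → d ∣ c
    goal (yes c%d≡0) = m%n≡0⇒n∣m c d c%d≡0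
    goal (no  c%d≢0) =
      contradiction (n≢0⇒n>0 c%d≢0 , completable-% 1≤L c≤m g-c g-d) (minimal (m%n<n c d))

  least-proper-divisor : ∀ {n d} → IsG m n s → Least (PositiveExponent n) d → d ∣ m × d < m
  least-proper-divisor gn least@(_ , minimal) with c , c<m , pos ← isG-exponent gn =
    least-∣ (isG-positive gn) least ≤-refl (completable-m _) ,
    ≤-<-trans (≮⇒≥ (λ c<d → minimal c<d pos)) c<m

  least-not-shared : ∀ {n n' d} → n < n' → IsG m n s → n' ≤ s →
                     Least (PositiveExponent n) d → Completable 1 n' d → ⊥
  least-not-shared {n} n<n' gn@((as , sq) , _) n'≤s least g-d = isG-no-shorter gn
    (shorter-sequence (isG-positive gn) n<s (sequence-occ-head sq) (sequence-occ<m sq n) g₀)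
    where
    n<s = <-≤-trans n<n' n'≤s
    c = occ s as
    c≤m = <⇒≤ (sequence-occ<m sq s)
    g-c : Completable 1 (suc n) c
    g-c = completable-∣ (least-∣ (isG-positive gn) least c≤m (sequence-completable sq))
                        (completable-mono n<n' g-d)
    g₀ : Completable (n ^ occ n as) (suc n) 0
    g₀ = subst (Completable (n ^ occ n as) (suc n)) (n∸n≡0 c)
      (completable-∸ (s≤s z≤n) ≤-refl c≤m (sequence-completable-above n<s sq) g-c)

  least-increasing : ∀ {n n' d d'} → n < n' → IsG m n s → IsG m n' s →
                     Least (PositiveExponent n) d → Least (PositiveExponent n') d' → d < d'
  least-increasing {d = d} {d'} n<n' gn gn' least@(_ , minimal) ((1≤d' , g-d') , _) =
    ≤∧≢⇒< d≤d' d≢d'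
    where
    d≤d' : d ≤ d'
    d≤d' = ≮⇒≥ (λ d'<d → minimal d'<d (1≤d' , completable-mono (<⇒≤ n<n') g-d'))
    d≢d' : d ≢ d'
    d≢d' refl = least-not-shared n<n' gn (isG-≤ gn') least g-d'

  LeastExponents : List ℕ → Set
  LeastExponents = All (λ n → ∃ (Least (PositiveExponent n)))

  least-exponents : ∀ {ns} → LeastExponents ns → List ℕ
  least-exponents = All.reduce proj₁

  length-least-exponents : ∀ {ns} (ls : LeastExponents ns) → length (least-exponents ls) ≡ length ns
  length-least-exponents []       = refl
  length-least-exponents (_ ∷ ls) = cong suc (length-least-exponents ls)

  least-exponents-increasing : ∀ {ns} → Linked _<_ ns → All (λ n → IsG m n s) ns →
                               (ls : LeastExponents ns) → Linked _<_ (least-exponents ls)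
  least-exponents-increasing []            []            []                          = []
  least-exponents-increasing [-]           _             (_ ∷ [])                    = [-]
  least-exponents-increasing (n<n' ∷ ns↗) (gn ∷ gn' ∷ gs) ((_ , l) ∷ (_ , l') ∷ ls) =
    least-increasing n<n' gn gn' l l' ∷ least-exponents-increasing ns↗ (gn' ∷ gs) ((_ , l') ∷ ls)

  least-exponents-proper-divisors : ∀ {ns} → All (λ n → IsG m n s) ns → (ls : LeastExponents ns) →
                                    All (λ d → d ∣ m × d < m) (least-exponents ls)
  least-exponents-proper-divisors []        []             = []
  least-exponents-proper-divisors (gn ∷ gs) ((_ , l) ∷ ls) =
    least-proper-divisor gn l ∷ least-exponents-proper-divisors gs ls

  ¬¬-least-exponents : ∀ ns → ¬ ¬ LeastExponents ns
  ¬¬-least-exponents ns = All.sequenceA 0ℓ (RawMonad.rawApplicative ¬¬-Monad)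
    (All.universal (λ n → ¬¬-least (0<m , completable-m n)) ns)

  length<numDivisors : ∀ {ns} → Linked _<_ ns → All (λ n → IsG m n s) ns → LeastExponents ns →
                       length ns < numDivisors m
  length<numDivisors ns↗ gs ls = subst (_< numDivisors m) (length-least-exponents ls)
    (proper-divisors-count (least-exponents-increasing ns↗ gs ls) (least-exponents-proper-divisors gs ls))

proposition5p13 : (m : ℕ) → 2 ≤ m → (ns : List ℕ) → Linked _<_ ns →
    (s : ℕ) → All (λ n → IsG m n s) ns → length ns < numDivisors m
proposition5p13 m 2≤m ns ns↗ zero gs =
  ≤-<-trans (at-most-one ns↗ (All.map isG-≤ gs)) (proper-divisors-count [-] ((1∣ m , 2≤m) ∷ []))
  where
  at-most-one : ∀ {ns} → Linked _<_ ns → All (_≤ 0) ns → length ns ≤ 1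
  at-most-one []            _              = z≤n
  at-most-one [-]           _              = ≤-refl
  at-most-one (n<n' ∷ _)   (_ ∷ n'≤0 ∷ _) = contradiction (≤-trans n<n' n'≤0) λ ()
proposition5p13 m 2≤m ns ns↗ (suc s) gs =
  decidable-stable (length ns <? numDivisors m)
    (¬¬-map (length<numDivisors ns↗ gs) (¬¬-least-exponents ns))
  where open Exponents m (suc s) 2≤m
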